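{- Let $G,H$ be graphs with $G,H\in\mathfrak{N}$, where $H$ is $r$-regular. Then the strong product $G\boxtimes H$ belongs to $\mathfrak{N}$. Moreover, $w(G\boxtimes H)\leq w(G)\cdot(r+1)+r$ and $W(G\boxtimes H)\geq W(G)\cdot(r+1)+r$.
   Context: All graphs are finite, undirected, without loops or multiple edges. An edge coloring of a graph $G$ with colors $1,2,\ldots,t$ is an interval $t$-coloring if every color $i\in\{1,\ldots,t\}$ is used on at least one edge, and for every vertex $v$ the colors of the edges incident to $v$ are pairwise distinct and form an interval of consecutive integers. $G$ is interval colorable if it has an interval $t$-coloring for some integer $t\geq 1$; $\mathfrak{N}$ denotes the set of interval colorable graphs. For $G\in\mathfrak{N}$, $w(G)$ and $W(G)$ denote the least and greatest $t$ for which $G$ has an interval $t$-coloring. The strong product $G\boxtimes H$ has vertex set $V(G)\times V(H)$, with $(u_1,v_1)$ adjacent to $(u_2,v_2)$ iff either ($u_1u_2\in E(G)$ and $v_1v_2\in E(H)$), or ($u_1=u_2$ and $v_1v_2\in E(H)$), or ($v_1=v_2$ and $u_1u_2\in E(G)$). -}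

module Defs where

open import Data.Nat using (ℕ; _≤_; _+_; _*_)
open import Data.Fin using (Fin; remQuot)
open import Data.Fin.Properties using (_≟_)
open import Data.Bool using (Bool; true; false; _∧_; _∨_)
open import Data.Product using (Σ; _×_; ∃; proj₁; proj₂)
open import Relation.Nullary using (¬_)
open import Relation.Nullary.Decidable using (⌊_⌋)
open import Relation.Binary.PropositionalEquality using (_≡_; _≢_)

record Graph : Set where
  field
    n       : ℕ
    adj     : Fin n → Fin n → Bool
    sym     : ∀ u v → adj u v ≡ adj v u
    irrefl  : ∀ u → adj u u ≡ false
open Graph public

Edge : (G : Graph) → Fin (n G) → Fin (n G) → Set
Edge G u v = adj G u v ≡ true

open import Data.List using (List; filter; length)
open import Data.List using () renaming (allFin to allFinL)
open import Data.Bool using (T)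
open import Data.Bool.Properties using (T?)

degree : (G : Graph) → Fin (n G) → ℕ
degree G v = length (filter (λ u → T? (adj G v u)) (allFinL (n G)))

Regular : Graph → ℕ → Set
Regular G r = ∀ v → degree G v ≡ r

-- An edge colouring is a function on ordered pairs of vertices whose
-- values on edges are symmetric (values on non-edges are irrelevant).
-- Interval t-colouring:
record IsIntervalColoring (G : Graph) (t : ℕ) (c : Fin (n G) → Fin (n G) → ℕ) : Set where
  field
    symmetric : ∀ u v → Edge G u v → c u v ≡ c v u
    inRange   : ∀ u v → Edge G u v → 1 ≤ c u v × c u v ≤ t
    allUsed   : ∀ i → 1 ≤ i → i ≤ t → Σ (Fin (n G)) λ u → Σ (Fin (n G)) λ v → Edge G u v × c u v ≡ i
    proper    : ∀ v u u' → Edge G v u → Edge G v u' → u ≢ u' → c v u ≢ c v u'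
    interval  : ∀ v u u' i → Edge G v u → Edge G v u' → c v u ≤ i → i ≤ c v u' →
                Σ (Fin (n G)) λ x → Edge G v x × c v x ≡ i

HasIntervalColoring : Graph → ℕ → Set
HasIntervalColoring G t = Σ (Fin (n G) → Fin (n G) → ℕ) (IsIntervalColoring G t)

IntervalColorable : Graph → Set
IntervalColorable G = Σ ℕ λ t → 1 ≤ t × HasIntervalColoring G t

IsLeastSpan : Graph → ℕ → Set
IsLeastSpan G w = (1 ≤ w × HasIntervalColoring G w) × (∀ t → 1 ≤ t → HasIntervalColoring G t → w ≤ t)

IsGreatestSpan : Graph → ℕ → Set
IsGreatestSpan G W = (1 ≤ W × HasIntervalColoring G W) × (∀ t → 1 ≤ t → HasIntervalColoring G t → t ≤ W)

-- Strong product; vertex (u , v) of G × H is encoded in Fin (n G * n H) via remQuot.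
private
  eqB : ∀ {k} → Fin k → Fin k → Bool
  eqB a b = ⌊ a ≟ b ⌋

strongAdj : (G H : Graph) → Fin (n G * n H) → Fin (n G * n H) → Bool
strongAdj G H x y =
  let u₁ = proj₁ (remQuot {n G} (n H) x) ; v₁ = proj₂ (remQuot {n G} (n H) x)
      u₂ = proj₁ (remQuot {n G} (n H) y) ; v₂ = proj₂ (remQuot {n G} (n H) y)
  in (adj G u₁ u₂ ∧ adj H v₁ v₂) ∨ (eqB u₁ u₂ ∧ adj H v₁ v₂) ∨ (eqB v₁ v₂ ∧ adj G u₁ u₂)

private
  open import Relation.Binary.PropositionalEquality using (refl; cong₂)
  open import Relation.Nullary using (yes; no)
  open import Data.Bool.Properties using (∧-zeroʳ)

  eqB-sym : ∀ {k} (a b : Fin k) → eqB a b ≡ eqB b a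
  eqB-sym a b with a ≟ b | b ≟ a
  ... | yes _ | yes _ = refl
  ... | no _  | no _  = refl
  ... | yes refl | no ¬p = Data.Empty.⊥-elim (¬p refl)
    where import Data.Empty
  ... | no ¬p | yes refl = Data.Empty.⊥-elim (¬p refl)
    where import Data.Empty

  eqB-refl : ∀ {k} (a : Fin k) → eqB a a ≡ true
  eqB-refl a with a ≟ a
  ... | yes _ = refl
  ... | no ¬p = Data.Empty.⊥-elim (¬p refl)
    where import Data.Empty

  strongSym : (G H : Graph) → ∀ x y → strongAdj G H x y ≡ strongAdj G H y x
  strongSym G H x y =
    let u₁ = proj₁ (remQuot {n G} (n H) x) ; v₁ = proj₂ (remQuot {n G} (n H) x)
        u₂ = proj₁ (remQuot {n G} (n H) y) ; v₂ = proj₂ (remQuot {n G} (n H) y)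
    in cong₂ _∨_ (cong₂ _∧_ (sym G u₁ u₂) (sym H v₁ v₂))
         (cong₂ _∨_ (cong₂ _∧_ (eqB-sym u₁ u₂) (sym H v₁ v₂))
                    (cong₂ _∧_ (eqB-sym v₁ v₂) (sym G u₁ u₂)))

  strongIrr : (G H : Graph) → ∀ x → strongAdj G H x x ≡ false
  irrLemma : ∀ a b c d → a ≡ false → b ≡ false → (a ∧ b) ∨ (c ∧ b) ∨ (d ∧ a) ≡ false
  irrLemma a b c d refl refl rewrite ∧-zeroʳ c | ∧-zeroʳ d = refl

  strongIrr G H x = irrLemma _ _ (eqB (proj₁ (remQuot {n G} (n H) x)) (proj₁ (remQuot {n G} (n H) x))) (eqB (proj₂ (remQuot {n G} (n H) x)) (proj₂ (remQuot {n G} (n H) x))) (irrefl G (proj₁ (remQuot {n G} (n H) x))) (irrefl H (proj₂ (remQuot {n G} (n H) x)))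

_⊠_ : Graph → Graph → Graph
G ⊠ H = record
  { n = n G * n H
  ; adj = strongAdj G H
  ; sym = strongSym G H
  ; irrefl = strongIrr G H
  }

-- Label each neighbour x of a vertex v of H by its colour modulo r: the r colours at v are
-- consecutive, so this is a bijection onto {0, …, r - 1}; label v itself by r. Given an interval
-- t-colouring c of G, colour an edge (u₁, v₁)(u₂, v₂) of G ⊠ H with u₁u₂ an edge of G by
-- (c(u₁u₂) - 1)(r + 1) + label_{v₁}(v₂) + 1, and an edge (u, v₁)(u, v₂) by M(u)(r + 1) + label_{v₁}(v₂) + 1,
-- where M(u) is the largest colour at u. At (u, v) this fills the whole block of r + 1 colours of every
-- colour of c at u and then the r colours above the topmost block: an interval (t(r + 1) + r)-colouring.
-- Applied to colourings of G with w(G) and W(G) colours it gives both bounds.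
module Submission where

open import Defs hiding (sym)
open import Data.Bool using (Bool; true; false; T; _∧_; _∨_; if_then_else_)
open import Data.Bool.Properties using (T?; ∧-zeroʳ)
open import Data.Empty using (⊥-elim)
open import Data.Fin using (Fin; toℕ; fromℕ<; punchOut; remQuot; combine)
open import Data.Fin.Properties
  using (_≟_; any?; injective⇒≤; punchOut-injective; fromℕ<-injective; toℕ-injective; toℕ<n;
         remQuot-combine; combine-remQuot)
open import Data.List using (List; filter; lookup; map)
  renaming (allFin to allFinL)
open import Data.List.Extrema.Nat using (max; xs≤max; max≤v⁺; argmax-sel)
open import Data.List.Membership.Propositional using (_∈_)
open import Data.List.Membership.Propositional.Properties
  using (∈-filter⁺; ∈-filter⁻; ∈-allFin; ∈-lookup; ∈-map⁺; ∈-map⁻)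
import Data.List.Relation.Unary.All as All
open import Data.List.Relation.Unary.AllPairs using (_∷_)
open import Data.List.Relation.Unary.Any using (index)
open import Data.List.Relation.Unary.Any.Properties using (lookup-index)
open import Data.List.Relation.Unary.Unique.Propositional using (Unique)
open import Data.List.Relation.Unary.Unique.Propositional.Properties using (filter⁺; allFin⁺)
open import Data.Nat using (ℕ; >-nonZero; s≤s⁻¹; suc; pred; _≤_; _<_; _≥_; _+_; _*_; z≤n; s≤s; NonZero; _<?_)
open import Data.Nat.DivMod using (_/_; _%_; _divMod_; result; m%n<n; m≡m%n+[m/n]*n; m*n/n≡m; m<n⇒m/n≡0; +-distrib-/-∣ʳ; /-monoˡ-≤)
open import Data.Nat.Divisibility using (divides)
open import Data.Nat.Properties hiding (_≟_)
open import Data.Product using (Σ; ∃; _×_; _,_; proj₁; proj₂; uncurry)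
open import Data.Sum using (_⊎_; inj₁; inj₂)
open import Data.Unit using (tt)
open import Function.Definitions using (Injective)
open import Relation.Nullary using (Dec; yes; no)
open import Relation.Nullary.Decidable using (⌊_⌋; dec-true; isYes≗does)
open import Relation.Binary.PropositionalEquality
open import Relation.Binary.Definitions using (tri<; tri≈; tri>)

private variable
  A : Set
  k m d : ℕ

∨-true⁻ : ∀ {x y} → x ∨ y ≡ true → x ≡ true ⊎ y ≡ true
∨-true⁻ {true}  _  = inj₁ refl
∨-true⁻ {false} eq = inj₂ eq

∧-true⁻ : ∀ {x y} → x ∧ y ≡ true → x ≡ true × y ≡ true
∧-true⁻ {true} eq = refl , eq

lookup-injective : ∀ {xs : List A} → Unique xs → Injective _≡_ _≡_ (lookup xs)
lookup-injective (_ ∷ _) {Fin.zero} {Fin.zero} _ = refl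
lookup-injective (x∉ ∷ _) {Fin.zero} {Fin.suc j} eq = ⊥-elim (All.lookup x∉ (∈-lookup j) eq)
lookup-injective (x∉ ∷ _) {Fin.suc i} {Fin.zero} eq = ⊥-elim (All.lookup x∉ (∈-lookup i) (sym eq))
lookup-injective (_ ∷ u) {Fin.suc i} {Fin.suc j} eq = cong Fin.suc (lookup-injective u eq)

injective⇒surjective : ∀ {f : Fin m → Fin k} → Injective _≡_ _≡_ f → k ≤ m → ∀ y → ∃ λ x → f x ≡ y
injective⇒surjective {m} {suc k} {f} f-inj k≤m y with any? (λ x → f x ≟ y)
... | yes hit = hit
... | no miss = ⊥-elim (<⇒≱ k≤m (injective⇒≤ avoiding-y-injective))
  where
  y≢f : ∀ x → y ≢ f x
  y≢f x y≡fx = miss (x , sym y≡fx)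
  avoiding-y : Fin m → Fin k
  avoiding-y x = punchOut (y≢f x)
  avoiding-y-injective : Injective _≡_ _≡_ avoiding-y
  avoiding-y-injective {x} {x′} eq = f-inj (punchOut-injective (y≢f x) (y≢f x′) eq)

module _ {d} .{{_ : NonZero d}} where

  [o+m*d]/d≡o/d+m : ∀ o m → (o + m * d) / d ≡ o / d + m
  [o+m*d]/d≡o/d+m o m = trans (+-distrib-/-∣ʳ o (divides m refl)) (cong (o / d +_) (m*n/n≡m m d))

  o+m*d≤o′+m′*d⇒m≤m′ : ∀ {o m o′ m′} → o′ < d → o + m * d ≤ o′ + m′ * d → m ≤ m′
  o+m*d≤o′+m′*d⇒m≤m′ {o} {m} {o′} {m′} o′<d le = begin
    m                   ≤⟨ m≤n+m m (o / d) ⟩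
    o / d + m           ≡⟨ [o+m*d]/d≡o/d+m o m ⟨
    (o + m * d) / d     ≤⟨ /-monoˡ-≤ d le ⟩
    (o′ + m′ * d) / d   ≡⟨ [o+m*d]/d≡o/d+m o′ m′ ⟩
    o′ / d + m′         ≡⟨ cong (_+ m′) (m<n⇒m/n≡0 o′<d) ⟩
    m′                  ∎
    where open ≤-Reasoning

  o+m*d≡o′+m′*d⇒m≡m′×o≡o′ : ∀ {o m o′ m′} → o < d → o′ < d → o + m * d ≡ o′ + m′ * d → m ≡ m′ × o ≡ o′
  o+m*d≡o′+m′*d⇒m≡m′×o≡o′ {o} {m} {o′} {m′} o<d o′<d eq = m≡m′ , +-cancelʳ-≡ (m * d) o o′ (trans eq (cong (λ q → o′ + q * d) (sym m≡m′)))
    where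
    m≡m′ : m ≡ m′
    m≡m′ = ≤-antisym (o+m*d≤o′+m′*d⇒m≤m′ o′<d (≤-reflexive eq)) (o+m*d≤o′+m′*d⇒m≤m′ o<d (≤-reflexive (sym eq)))

  m%d≡n%d⇒m+d≤n : ∀ {m n} → m % d ≡ n % d → m < n → m + d ≤ n
  m%d≡n%d⇒m+d≤n {m} {n} eq m<n = begin
    m + d                       ≡⟨ cong (_+ d) (m≡m%n+[m/n]*n m d) ⟩
    m % d + m / d * d + d       ≡⟨ +-assoc (m % d) (m / d * d) d ⟩
    m % d + (m / d * d + d)     ≡⟨ cong (m % d +_) (+-comm (m / d * d) d) ⟩
    m % d + suc (m / d) * d     ≤⟨ +-mono-≤ (≤-reflexive eq) (*-monoˡ-≤ d quotient<) ⟩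
    n % d + n / d * d           ≡⟨ m≡m%n+[m/n]*n n d ⟨
    n                           ∎
    where
    open ≤-Reasoning
    quotient< : m / d < n / d
    quotient< = ≰⇒> λ n/d≤m/d → <⇒≱ m<n (begin
      n                  ≡⟨ m≡m%n+[m/n]*n n d ⟩
      n % d + n / d * d  ≤⟨ +-mono-≤ (≤-reflexive (sym eq)) (*-monoˡ-≤ d n/d≤m/d) ⟩
      m % d + m / d * d  ≡⟨ m≡m%n+[m/n]*n m d ⟨
      m                  ∎)

module _ (G : Graph) where

  neighbours : Fin (n G) → List (Fin (n G))
  neighbours v = filter (λ u → T? (adj G v u)) (allFinL (n G))

  ∈-neighbours⁺ : ∀ {v u} → Edge G v u → u ∈ neighbours v
  ∈-neighbours⁺ {v} {u} e = ∈-filter⁺ (λ u → T? (adj G v u)) (∈-allFin u) (subst T (sym e) tt)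

  ∈-neighbours⁻ : ∀ {v u} → u ∈ neighbours v → Edge G v u
  ∈-neighbours⁻ {v} {u} u∈ with adj G v u | proj₂ (∈-filter⁻ (λ u → T? (adj G v u)) {xs = allFinL (n G)} u∈)
  ... | true | _ = refl

  neighbours-unique : ∀ v → Unique (neighbours v)
  neighbours-unique v = filter⁺ (λ u → T? (adj G v u)) (allFin⁺ (n G))

  injective⇒≤degree : ∀ {v} (f : Fin k → Fin (n G)) → (∀ i → Edge G v (f i)) → Injective _≡_ _≡_ f →
                      k ≤ degree G v
  injective⇒≤degree {v = v} f edge f-inj = injective⇒≤ position-injective
    where
    position : Fin _ → Fin (degree G v)
    position i = index (∈-neighbours⁺ (edge i))
    position-injective : Injective _≡_ _≡_ position
    position-injective {i} {j} eq = f-inj (begin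
      f i                                  ≡⟨ lookup-index (∈-neighbours⁺ (edge i)) ⟩
      lookup (neighbours v) (position i)   ≡⟨ cong (lookup (neighbours v)) eq ⟩
      lookup (neighbours v) (position j)   ≡⟨ lookup-index (∈-neighbours⁺ (edge j)) ⟨
      f j                                  ∎)
      where open ≡-Reasoning

  injective-labelling-surjective : ∀ {v} (ℓ : Fin (n G) → ℕ) → (∀ {x} → Edge G v x → ℓ x < d) →
    (∀ {x y} → Edge G v x → Edge G v y → ℓ x ≡ ℓ y → x ≡ y) → d ≤ degree G v →
    ∀ {s} → s < d → ∃ λ x → Edge G v x × ℓ x ≡ s
  injective-labelling-surjective {v = v} ℓ ℓ<d ℓ-injective d≤degree {s} s<d =
    let j , label-j≡s = injective⇒surjective label-injective d≤degree (fromℕ< s<d)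
    in  nbr j , nbr-edge j , fromℕ<-injective _ _ (ℓ<d (nbr-edge j)) s<d label-j≡s
    where
    nbr : Fin (degree G v) → Fin (n G)
    nbr = lookup (neighbours v)
    nbr-edge : ∀ j → Edge G v (nbr j)
    nbr-edge j = ∈-neighbours⁻ (∈-lookup j)
    label : Fin (degree G v) → Fin _
    label j = fromℕ< (ℓ<d (nbr-edge j))
    label-injective : Injective _≡_ _≡_ label
    label-injective {i} {j} eq = lookup-injective (neighbours-unique v)
      (ℓ-injective (nbr-edge i) (nbr-edge j) (fromℕ<-injective _ _ (ℓ<d (nbr-edge i)) (ℓ<d (nbr-edge j)) eq))

data ClosedNbr (G : Graph) (v : Fin (n G)) : Fin (n G) → Set where
  self     : ClosedNbr G v v
  adjacent : ∀ {x} → Edge G v x → ClosedNbr G v x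

proper⇒injective : ∀ {G t c} → IsIntervalColoring G t c →
                   ∀ {v x y} → Edge G v x → Edge G v y → c v x ≡ c v y → x ≡ y
proper⇒injective χ {v} {x} {y} ex ey same with x ≟ y
... | yes x≡y = x≡y
... | no  x≢y = ⊥-elim (IsIntervalColoring.proper χ v x y ex ey x≢y same)

module TopColour {G t c} (χ : IsIntervalColoring G t c) where
  open IsIntervalColoring χ

  top : Fin (n G) → ℕ
  top u = max 0 (map (c u) (neighbours G u))

  colour≤top : ∀ {u x} → Edge G u x → c u x ≤ top u
  colour≤top {u} e = All.lookup (xs≤max 0 (map (c u) (neighbours G u))) (∈-map⁺ (c u) (∈-neighbours⁺ G e))

  top≤span : ∀ u → top u ≤ t
  top≤span u = max≤v⁺ z≤n (All.tabulate λ c∈ →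
    let x , x∈ , eq = ∈-map⁻ (c u) c∈ in subst (_≤ t) (sym eq) (proj₂ (inRange u x (∈-neighbours⁻ G x∈))))

  top-attained : ∀ {u x} → Edge G u x → ∃ λ y → Edge G u y × c u y ≡ top u
  top-attained {u} {x} e with argmax-sel (λ i → i) 0 (map (c u) (neighbours G u))
  ... | inj₁ top≡0 = ⊥-elim (<⇒≱ (≤-trans (proj₁ (inRange u x e)) (colour≤top e)) (≤-reflexive top≡0))
  ... | inj₂ top∈ = let y , y∈ , eq = ∈-map⁻ (c u) top∈ in y , ∈-neighbours⁻ G y∈ , sym eq

edge-sym : ∀ G {u v} → Edge G u v → Edge G v u
edge-sym G {u} {v} e = trans (Graph.sym G v u) e

module ModularLabelling {H r tH cH} .{{_ : NonZero r}} (regular : Regular H r) (χ : IsIntervalColoring H tH cH) where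
  open IsIntervalColoring χ

  label : Fin (n H) → Fin (n H) → ℕ
  label v x = cH v x % r

  label<r : ∀ v x → label v x < r
  label<r v x = m%n<n (cH v x) r

  label-sym : ∀ {v x} → Edge H v x → label v x ≡ label x v
  label-sym {v} {x} e = cong (_% r) (symmetric v x e)

  -- Colours at v congruent modulo r would enclose r + 1 colours at v, hence r + 1 neighbours.
  colour<⇒label≢ : ∀ {v x y} → Edge H v x → Edge H v y → cH v x < cH v y → label v x ≢ label v y
  colour<⇒label≢ {v} {x} {y} ex ey x<y same =
    1+n≰n (≤-trans (injective⇒≤degree H witness witness-edge witness-injective) (≤-reflexive (regular v)))
    where
    between : ∀ (k : Fin (suc r)) → Σ (Fin (n H)) λ z → Edge H v z × cH v z ≡ cH v x + toℕ k
    between k = interval v x y (cH v x + toℕ k) ex ey (m≤m+n _ _)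
      (≤-trans (+-monoʳ-≤ (cH v x) (m<1+n⇒m≤n (toℕ<n k))) (m%d≡n%d⇒m+d≤n same x<y))
    witness : Fin (suc r) → Fin (n H)
    witness k = proj₁ (between k)
    witness-edge : ∀ k → Edge H v (witness k)
    witness-edge k = proj₁ (proj₂ (between k))
    witness-injective : Injective _≡_ _≡_ witness
    witness-injective {k} {k′} eq = toℕ-injective (+-cancelˡ-≡ (cH v x) _ _
      (trans (sym (proj₂ (proj₂ (between k)))) (trans (cong (cH v) eq) (proj₂ (proj₂ (between k′))))))

  label-injective : ∀ {v x y} → Edge H v x → Edge H v y → label v x ≡ label v y → x ≡ y
  label-injective {v} {x} {y} ex ey same with <-cmp (cH v x) (cH v y)
  ... | tri< x<y _ _ = ⊥-elim (colour<⇒label≢ ex ey x<y same)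
  ... | tri≈ _ x≈y _ = proper⇒injective χ ex ey x≈y
  ... | tri> _ _ y<x = ⊥-elim (colour<⇒label≢ ey ex y<x (sym same))

  label-surjective : ∀ v {s} → s < r → ∃ λ x → Edge H v x × label v x ≡ s
  label-surjective v = injective-labelling-surjective H (label v) (λ {x} _ → label<r v x) label-injective
    (≤-reflexive (sym (regular v)))

  closedLabel : Fin (n H) → Fin (n H) → ℕ
  closedLabel v x = if adj H v x then label v x else r

  closedLabel≤r : ∀ v x → closedLabel v x ≤ r
  closedLabel≤r v x with adj H v x
  ... | true  = <⇒≤ (label<r v x)
  ... | false = ≤-refl

  closedLabel-self : ∀ v → closedLabel v v ≡ r
  closedLabel-self v rewrite irrefl H v = refl

  closedLabel-adjacent : ∀ {v x} → Edge H v x → closedLabel v x ≡ label v x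
  closedLabel-adjacent e rewrite e = refl

  closedLabel-sym : ∀ {v x} → ClosedNbr H v x → closedLabel v x ≡ closedLabel x v
  closedLabel-sym self         = refl
  closedLabel-sym (adjacent e) =
    trans (closedLabel-adjacent e) (trans (label-sym e) (sym (closedLabel-adjacent (edge-sym H e))))

  closedLabel-injective : ∀ {v x y} → ClosedNbr H v x → ClosedNbr H v y → closedLabel v x ≡ closedLabel v y → x ≡ y
  closedLabel-injective self          self          _    = refl
  closedLabel-injective {v} self      (adjacent ey) same =
    ⊥-elim (<-irrefl (trans (sym (closedLabel-adjacent ey)) (trans (sym same) (closedLabel-self v))) (label<r v _))
  closedLabel-injective {v} (adjacent ex) self      same =
    ⊥-elim (<-irrefl (trans (sym (closedLabel-adjacent ex)) (trans same (closedLabel-self v))) (label<r v _))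
  closedLabel-injective (adjacent ex) (adjacent ey) same =
    label-injective ex ey (trans (sym (closedLabel-adjacent ex)) (trans same (closedLabel-adjacent ey)))

  closedLabel-surjective : ∀ v {s} → s ≤ r → ∃ λ x → ClosedNbr H v x × closedLabel v x ≡ s
  closedLabel-surjective v s≤r with m≤n⇒m<n∨m≡n s≤r
  ... | inj₁ s<r  = let x , e , label≡s = label-surjective v s<r
                    in x , adjacent e , trans (closedLabel-adjacent e) label≡s
  ... | inj₂ refl = v , self , closedLabel-self v

dec-true⁻¹ : ∀ {P : Set} (p? : Dec P) → ⌊ p? ⌋ ≡ true → P
dec-true⁻¹ (yes p) _ = p

⌊≟⌋-refl : ∀ {k} (a : Fin k) → ⌊ a ≟ a ⌋ ≡ true
⌊≟⌋-refl a = trans (isYes≗does (a ≟ a)) (dec-true (a ≟ a) refl)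

module _ (G H : Graph) where

  data StrongEdge : Fin (n G) × Fin (n H) → Fin (n G) × Fin (n H) → Set where
    across : ∀ {u₁ u₂ v₁ v₂} → Edge G u₁ u₂ → ClosedNbr H v₁ v₂ → StrongEdge (u₁ , v₁) (u₂ , v₂)
    within : ∀ {u v₁ v₂} → Edge H v₁ v₂ → StrongEdge (u , v₁) (u , v₂)

  coords : Fin (n (G ⊠ H)) → Fin (n G) × Fin (n H)
  coords = remQuot {n G} (n H)

  fromCoords : Fin (n G) × Fin (n H) → Fin (n (G ⊠ H))
  fromCoords = uncurry combine

  coords-fromCoords : ∀ p → coords (fromCoords p) ≡ p
  coords-fromCoords (u , v) = remQuot-combine u v

  coords-injective : ∀ {x y} → coords x ≡ coords y → x ≡ y
  coords-injective {x} {y} eq =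
    trans (sym (combine-remQuot {n G} (n H) x)) (trans (cong fromCoords eq) (combine-remQuot {n G} (n H) y))

  adjCoords : Fin (n G) × Fin (n H) → Fin (n G) × Fin (n H) → Bool
  adjCoords (u₁ , v₁) (u₂ , v₂) =
    (adj G u₁ u₂ ∧ adj H v₁ v₂) ∨ (⌊ u₁ ≟ u₂ ⌋ ∧ adj H v₁ v₂) ∨ (⌊ v₁ ≟ v₂ ⌋ ∧ adj G u₁ u₂)

  adjCoords⇒StrongEdge : ∀ {p q} → adjCoords p q ≡ true → StrongEdge p q
  adjCoords⇒StrongEdge {u₁ , v₁} {u₂ , v₂} e with ∨-true⁻ e
  ... | inj₁ both = across (proj₁ (∧-true⁻ both)) (adjacent (proj₂ (∧-true⁻ both)))
  ... | inj₂ rest with ∨-true⁻ rest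
  ...   | inj₁ fibre with refl ← dec-true⁻¹ (u₁ ≟ u₂) (proj₁ (∧-true⁻ fibre)) = within (proj₂ (∧-true⁻ fibre))
  ...   | inj₂ layer with refl ← dec-true⁻¹ (v₁ ≟ v₂) (proj₁ (∧-true⁻ layer)) = across (proj₂ (∧-true⁻ layer)) self

  StrongEdge⇒adjCoords : ∀ {p q} → StrongEdge p q → adjCoords p q ≡ true
  StrongEdge⇒adjCoords (across a (adjacent h)) rewrite a | h = refl
  StrongEdge⇒adjCoords (across {u₁} {u₂} {v} a self)
    rewrite a | irrefl H v | ⌊≟⌋-refl v | ∧-zeroʳ ⌊ u₁ ≟ u₂ ⌋ = refl
  StrongEdge⇒adjCoords (within {u} h) rewrite irrefl G u | ⌊≟⌋-refl u | h = refl

  ⊠-edge⁻ : ∀ {x y} → Edge (G ⊠ H) x y → StrongEdge (coords x) (coords y)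
  ⊠-edge⁻ = adjCoords⇒StrongEdge

  ⊠-edge⁺ : ∀ {x q} → StrongEdge (coords x) q → Edge (G ⊠ H) x (fromCoords q)
  ⊠-edge⁺ {x} {q} e = StrongEdge⇒adjCoords (subst (StrongEdge (coords x)) (sym (coords-fromCoords q)) e)

module StrongProductColouring
  {G H : Graph} {r t tH : ℕ} {cG : Fin (n G) → Fin (n G) → ℕ} {cH : Fin (n H) → Fin (n H) → ℕ} .{{_ : NonZero r}}
  (regular : Regular H r) (χH : IsIntervalColoring H tH cH) (χG : IsIntervalColoring G t cG) where
  open ModularLabelling regular χH
  open TopColour χG
  private module χG = IsIntervalColoring χG

  V : Set
  V = Fin (n G) × Fin (n H)

  block : ℕ → ℕ → ℕ
  block q s = suc (s + q * suc r)

  colour : V → V → ℕ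
  colour (u₁ , v₁) (u₂ , v₂) =
    if adj G u₁ u₂ then block (pred (cG u₁ u₂)) (closedLabel v₁ v₂) else block (top u₁) (label v₁ v₂)

  level : ∀ {p q} → StrongEdge G H p q → ℕ
  level (across {u₁} {u₂} _ _) = pred (cG u₁ u₂)
  level (within {u} _)         = top u

  offset : ∀ {p q} → StrongEdge G H p q → ℕ
  offset (across {v₁ = v₁} {v₂ = v₂} _ _) = closedLabel v₁ v₂
  offset (within {v₁ = v₁} {v₂ = v₂} _)   = label v₁ v₂

  colour≡block : ∀ {p q} (e : StrongEdge G H p q) → colour p q ≡ block (level e) (offset e)
  colour≡block (across a _)   rewrite a          = refl
  colour≡block (within {u} _) rewrite irrefl G u = refl

  offset≤r : ∀ {p q} (e : StrongEdge G H p q) → offset e ≤ r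
  offset≤r (across {v₁ = v₁} {v₂ = v₂} _ _) = closedLabel≤r v₁ v₂
  offset≤r (within {v₁ = v₁} {v₂ = v₂} _)   = <⇒≤ (label<r v₁ v₂)

  suc-pred-colour : ∀ {u x} → Edge G u x → suc (pred (cG u x)) ≡ cG u x
  suc-pred-colour {u} {x} a = suc-pred (cG u x) {{>-nonZero (proj₁ (χG.inRange u x a))}}

  across-level<top : ∀ {u₁ u₂} → Edge G u₁ u₂ → pred (cG u₁ u₂) < top u₁
  across-level<top a = ≤-trans (≤-reflexive (suc-pred-colour a)) (colour≤top a)

  block-injective : ∀ {q s q′ s′} → s ≤ r → s′ ≤ r → block q s ≡ block q′ s′ → q ≡ q′ × s ≡ s′
  block-injective s≤r s′≤r eq = o+m*d≡o′+m′*d⇒m≡m′×o≡o′ (s≤s s≤r) (s≤s s′≤r) (suc-injective eq)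

  block-level-mono : ∀ {q s q′ s′} → s′ ≤ r → block q s ≤ block q′ s′ → q ≤ q′
  block-level-mono s′≤r le = o+m*d≤o′+m′*d⇒m≤m′ (s≤s s′≤r) (s≤s⁻¹ le)

  block-offset-mono : ∀ {q s s′} → block q s ≤ block q s′ → s ≤ s′
  block-offset-mono {q} {s} {s′} le = +-cancelʳ-≤ (q * suc r) s s′ (s≤s⁻¹ le)

  block-surjective : ∀ i → 1 ≤ i → Σ ℕ λ q → Σ ℕ λ s → s ≤ r × i ≡ block q s
  block-surjective (suc j) _ with j divMod suc r
  ... | result q s j≡ = q , toℕ s , s≤s⁻¹ (toℕ<n s) , cong suc j≡

  block≤span : ∀ {q s} → q < t → s ≤ r → block q s ≤ t * suc r + r
  block≤span {q} {s} q<t s≤r = begin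
    suc s + q * suc r   ≤⟨ +-monoˡ-≤ (q * suc r) (s≤s s≤r) ⟩
    suc q * suc r       ≤⟨ *-monoˡ-≤ (suc r) q<t ⟩
    t * suc r           ≤⟨ m≤m+n (t * suc r) r ⟩
    t * suc r + r       ∎
    where open ≤-Reasoning

  top-block≤span : ∀ u {s} → s < r → block (top u) s ≤ t * suc r + r
  top-block≤span u {s} s<r = begin
    suc s + top u * suc r   ≤⟨ +-mono-≤ s<r (*-monoˡ-≤ (suc r) (top≤span u)) ⟩
    r + t * suc r           ≡⟨ +-comm r (t * suc r) ⟩
    t * suc r + r           ∎
    where open ≤-Reasoning

  colour-inRange : ∀ {p q} → StrongEdge G H p q → 1 ≤ colour p q × colour p q ≤ t * suc r + r
  colour-inRange e rewrite colour≡block e = s≤s z≤n , bound e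
    where
    bound : ∀ {p q} (e : StrongEdge G H p q) → block (level e) (offset e) ≤ t * suc r + r
    bound (across {u₁} {u₂} {v₁} {v₂} a _) =
      block≤span (≤-trans (≤-reflexive (suc-pred-colour a)) (proj₂ (χG.inRange u₁ u₂ a))) (closedLabel≤r v₁ v₂)
    bound (within {u} {v₁} {v₂} _) = top-block≤span u (label<r v₁ v₂)

  colour-sym : ∀ {p q} → StrongEdge G H p q → colour p q ≡ colour q p
  colour-sym (across {u₁} {u₂} a c) rewrite a | edge-sym G a =
    cong₂ block (cong pred (χG.symmetric u₁ u₂ a)) (closedLabel-sym c)
  colour-sym (within {u} h) rewrite irrefl G u = cong (block (top u)) (label-sym h)

  colour-injective : ∀ {p q q′} → StrongEdge G H p q → StrongEdge G H p q′ → colour p q ≡ colour p q′ → q ≡ q′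
  colour-injective e e′ same
    with block-injective {level e} {offset e} {level e′} (offset≤r e) (offset≤r e′) (trans (sym (colour≡block e)) (trans same (colour≡block e′)))
  colour-injective (across a c) (across a′ c′) _ | level≡ , offset≡ =
    cong₂ _,_ (proper⇒injective χG a a′ (trans (sym (suc-pred-colour a)) (trans (cong suc level≡) (suc-pred-colour a′))))
              (closedLabel-injective c c′ offset≡)
  colour-injective (across a _) (within _) _ | level≡ , _ = ⊥-elim (<-irrefl level≡ (across-level<top a))
  colour-injective (within _) (across a _) _ | level≡ , _ = ⊥-elim (<-irrefl (sym level≡) (across-level<top a))
  colour-injective (within h) (within h′) _ | _ , offset≡ = cong (_ ,_) (label-injective h h′ offset≡)

  Present : V → ℕ → Set
  Present p i = Σ V λ q → StrongEdge G H p q × colour p q ≡ i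

  across-present : ∀ {u u′} v → Edge G u u′ → ∀ {s} → s ≤ r → Present (u , v) (block (pred (cG u u′)) s)
  across-present {u} {u′} v a s≤r =
    let x , c , label≡s = closedLabel-surjective v s≤r
    in  (u′ , x) , across a c , trans (colour≡block (across a c)) (cong (block (pred (cG u u′))) label≡s)

  within-present : ∀ u v {s} → s < r → Present (u , v) (block (top u) s)
  within-present u v s<r =
    let x , h , label≡s = label-surjective v s<r
    in  (u , x) , within h , trans (colour≡block (within h)) (cong (block (top u)) label≡s)

  below-top-present : ∀ {u u₁} v → Edge G u u₁ → ∀ {q s} → pred (cG u u₁) ≤ q → q < top u → s ≤ r →
                      Present (u , v) (block q s)
  below-top-present {u} {u₁} v a₁ {q} pred≤q q<top s≤r =
    let y , a-top , c≡top = top-attained a₁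
        u′ , a′ , c≡suc-q = χG.interval u u₁ y (suc q) a₁ a-top
          (≤-trans (≤-reflexive (sym (suc-pred-colour a₁))) (s≤s pred≤q)) (≤-trans q<top (≤-reflexive (sym c≡top)))
    in  subst (λ l → Present (u , v) (block l _)) (cong pred c≡suc-q) (across-present v a′ s≤r)

  colour-interval : ∀ {u v q₁ q₂ i} → StrongEdge G H (u , v) q₁ → StrongEdge G H (u , v) q₂ →
                    colour (u , v) q₁ ≤ i → i ≤ colour (u , v) q₂ → Present (u , v) i
  colour-interval {u} {v} {i = i} e₁ e₂ c₁≤i i≤c₂ with block-surjective i (≤-trans (proj₁ (colour-inRange e₁)) c₁≤i)
  ... | q , s , s≤r , refl with q <? top u
  ...   | yes q<top = below e₁ (≤-trans (≤-reflexive (sym (colour≡block e₁))) c₁≤i)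
    where
    below : ∀ {q₁} (e : StrongEdge G H (u , v) q₁) → block (level e) (offset e) ≤ block q s → Present (u , v) (block q s)
    below (across a₁ _) le = below-top-present v a₁ (block-level-mono s≤r le) q<top s≤r
    below (within _)    le = ⊥-elim (<⇒≱ q<top (block-level-mono s≤r le))
  ...   | no q≮top = above e₂ (≤-trans i≤c₂ (≤-reflexive (colour≡block e₂)))
    where
    above : ∀ {q₂} (e : StrongEdge G H (u , v) q₂) → block q s ≤ block (level e) (offset e) → Present (u , v) (block q s)
    above e@(across a₂ _) le = ⊥-elim (q≮top (≤-<-trans (block-level-mono (offset≤r e) le) (across-level<top a₂)))
    above e@(within {v₂ = v₂} _) le with refl ← ≤-antisym (block-level-mono (offset≤r e) le) (≮⇒≥ q≮top) =
      within-present u v (≤-<-trans (block-offset-mono {top u} le) (label<r v v₂))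

  top-level-present : 1 ≤ t → ∀ v {s} → s < r → Σ V λ p → Present p (block t s)
  top-level-present 1≤t v s<r =
    let u , _ , a , c≡t = χG.allUsed t 1≤t ≤-refl
        top≡t = ≤-antisym (top≤span u) (≤-trans (≤-reflexive (sym c≡t)) (colour≤top a))
    in  (u , v) , subst (λ l → Present (u , v) (block l _)) top≡t (within-present u v s<r)

  colour-surjective : 1 ≤ t → Fin (n H) → ∀ i → 1 ≤ i → i ≤ t * suc r + r → Σ V λ p → Present p i
  colour-surjective 1≤t v₀ i 1≤i i≤span with block-surjective i 1≤i
  ... | q , s , s≤r , refl with q <? t
  ...   | yes q<t =
    let u₁ , u₂ , a , c≡suc-q = χG.allUsed (suc q) (s≤s z≤n) q<t
    in  (u₁ , v₀) , subst (λ l → Present (u₁ , v₀) (block l s)) (cong pred c≡suc-q) (across-present v₀ a s≤r)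
  ...   | no q≮t = subst (λ l → Σ V λ p → Present p (block l s)) (sym q≡t) (top-level-present 1≤t v₀ s<r)
    where
    q≡t : q ≡ t
    q≡t = ≤-antisym (block-level-mono ≤-refl (≤-trans i≤span span<block)) (≮⇒≥ q≮t)
      where
      span<block : t * suc r + r ≤ block t r
      span<block = ≤-trans (n≤1+n _) (≤-reflexive (cong suc (+-comm (t * suc r) r)))
    span≡ : t * suc r + r ≡ r + q * suc r
    span≡ = trans (+-comm (t * suc r) r) (cong (λ l → r + l * suc r) (sym q≡t))
    s<r : s < r
    s<r = +-cancelʳ-≤ (q * suc r) (suc s) r (≤-trans i≤span (≤-reflexive span≡))

  ⊠-colour : Fin (n (G ⊠ H)) → Fin (n (G ⊠ H)) → ℕ
  ⊠-colour x y = colour (coords G H x) (coords G H y)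

  ⊠-present : ∀ {x i} → Present (coords G H x) i → Σ (Fin (n (G ⊠ H))) λ z → Edge (G ⊠ H) x z × ⊠-colour x z ≡ i
  ⊠-present {x} (q , e , colour≡i) =
    fromCoords G H q , ⊠-edge⁺ G H e , trans (cong (colour (coords G H x)) (coords-fromCoords G H q)) colour≡i

  ⊠-isIntervalColoring : 1 ≤ t → Fin (n H) → IsIntervalColoring (G ⊠ H) (t * suc r + r) ⊠-colour
  ⊠-isIntervalColoring 1≤t v₀ = record
    { symmetric = λ _ _ e → colour-sym (⊠-edge⁻ G H e)
    ; inRange   = λ _ _ e → colour-inRange (⊠-edge⁻ G H e)
    ; allUsed   = λ i 1≤i i≤span → let p , present = colour-surjective 1≤t v₀ i 1≤i i≤span in
        fromCoords G H p , ⊠-present (subst (λ p′ → Present p′ i) (sym (coords-fromCoords G H p)) present)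
    ; proper    = λ _ _ _ e e′ y≢y′ same → y≢y′ (coords-injective G H (colour-injective (⊠-edge⁻ G H e) (⊠-edge⁻ G H e′) same))
    ; interval  = λ _ _ _ _ e e′ lo hi → ⊠-present (colour-interval (⊠-edge⁻ G H e) (⊠-edge⁻ G H e′) lo hi)
    }

edge⇒degree>0 : ∀ G {v x} → Edge G v x → 0 < degree G v
edge⇒degree>0 G {x = x} e = injective⇒≤degree G (λ _ → x) (λ _ → e) λ { {Fin.zero} {Fin.zero} _ → refl }

⊠-hasIntervalColoring : ∀ {G H r t} → IntervalColorable H → Regular H r → 1 ≤ t → HasIntervalColoring G t →
                        HasIntervalColoring (G ⊠ H) (t * (r + 1) + r)
⊠-hasIntervalColoring {G} {H} {r} {t} (tH , 1≤tH , cH , χH) regular 1≤t (cG , χG) =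
  let v₀ , x₀ , e , _ = IsIntervalColoring.allUsed χH 1 ≤-refl 1≤tH
      instance r>0 = >-nonZero (subst (0 <_) (regular v₀) (edge⇒degree>0 H e))
      open StrongProductColouring regular χH χG
  in  subst (λ d → HasIntervalColoring (G ⊠ H) (t * d + r)) (+-comm 1 r) (⊠-colour , ⊠-isIntervalColoring 1≤t v₀)

theorem14 : (G H : Graph) (r : ℕ) → IntervalColorable G → IntervalColorable H → Regular H r →
    IntervalColorable (G ⊠ H)
    × (∀ w w' → IsLeastSpan G w → IsLeastSpan (G ⊠ H) w' → w' ≤ w * (r + 1) + r)
    × (∀ W W' → IsGreatestSpan G W → IsGreatestSpan (G ⊠ H) W' → W' ≥ W * (r + 1) + r)
theorem14 G H r (t , 1≤t , χG) χH regular =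
  (t * (r + 1) + r , span>0 1≤t , product 1≤t χG) ,
  (λ { _ _ ((1≤w , χw) , _) (_ , least)    → least _ (span>0 1≤w) (product 1≤w χw) }) ,
  (λ { _ _ ((1≤W , χW) , _) (_ , greatest) → greatest _ (span>0 1≤W) (product 1≤W χW) })
  where
  product : ∀ {t} → 1 ≤ t → HasIntervalColoring G t → HasIntervalColoring (G ⊠ H) (t * (r + 1) + r)
  product = ⊠-hasIntervalColoring χH regular
  span>0 : ∀ {t} → 1 ≤ t → 1 ≤ t * (r + 1) + r
  span>0 {t} 1≤t = ≤-trans 1≤t (≤-trans (m≤m*n t (r + 1) {{>-nonZero (m≤n+m 1 r)}}) (m≤m+n _ r))
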